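{- Let $p$ and $q$ be positive integers with $p \neq q$, $\gcd(p,q) = 1$ and $p + q$ odd. For each positive integer $n$, let $m(n)$ denote the greatest integer $m \ge 1$ such that the grid graph $\square_m$ embeds into the leaper graph $\mathcal{L}_n$ of the $(p,q)$-leaper. Then there is a constant $C$, depending only on $p$ and $q$ (and not on $n$), such that $|m(n) - n| \le C$ for all positive integers $n$; i.e., $m(n) = n + O_{p,q}(1)$.
   Context: Let $[n] = \{1, 2, \ldots, n\}$. The grid graph $\square_n$ has vertex set $[n]^2$, with $(x', y')$ and $(x'', y'')$ adjacent iff they are at Euclidean distance $1$. For positive integers $p \ne q$, the $(p,q)$-leaper graph $\mathcal{L}_n$ has vertex set $[n]^2$, with $(x', y')$ and $(x'', y'')$ adjacent iff $\{|x' - x''|, |y' - y''|\} = \{p, q\}$. A graph $G$ embeds into a graph $H$ if $G$ is isomorphic to a (not necessarily induced) subgraph of $H$. -}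

module Defs where

open import Data.Nat using (ℕ; suc; _+_; _≤_; ∣_-_∣)
open import Data.Fin using (Fin; toℕ)
open import Data.Product using (_×_; Σ; _,_)
open import Data.Sum using (_⊎_)
open import Relation.Binary.PropositionalEquality using (_≡_)
open import Function.Definitions using (Injective)

-- Vertex set [n]^2, realised as Fin n × Fin n (coordinates shifted by 1;
-- adjacency depends only on coordinate differences, so this is harmless).
Vertex : ℕ → Set
Vertex n = Fin n × Fin n

dx : ∀ {n} → Vertex n → Vertex n → ℕ
dx (x₁ , _) (x₂ , _) = ∣ toℕ x₁ - toℕ x₂ ∣

dy : ∀ {n} → Vertex n → Vertex n → ℕ
dy (_ , y₁) (_ , y₂) = ∣ toℕ y₁ - toℕ y₂ ∣

GridAdj : (n : ℕ) → Vertex n → Vertex n → Set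
GridAdj n u v = (dx u v ≡ 1 × dy u v ≡ 0) ⊎ (dx u v ≡ 0 × dy u v ≡ 1)

LeaperAdj : (p q n : ℕ) → Vertex n → Vertex n → Set
LeaperAdj p q n u v = (dx u v ≡ p × dy u v ≡ q) ⊎ (dx u v ≡ q × dy u v ≡ p)

Embeds : (V : Set) → (V → V → Set) → (W : Set) → (W → W → Set) → Set
Embeds V E W F =
  Σ (V → W) λ f → Injective _≡_ _≡_ f × (∀ u v → E u v → F (f u) (f v))

GridEmbedsLeaper : (p q m n : ℕ) → Set
GridEmbedsLeaper p q m n =
  Embeds (Vertex m) (GridAdj m) (Vertex n) (LeaperAdj p q n)

IsMaxGrid : (p q n m : ℕ) → Set
IsMaxGrid p q n m =
  1 ≤ m × GridEmbedsLeaper p q m n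
  × (∀ m′ → 1 ≤ m′ → GridEmbedsLeaper p q m′ n → m′ ≤ m)

-- Since □_m has m² vertices, m(n) ≤ n, and the content is an embedding of □_m
-- into L_(m + C).  Let p < q.  For a walk i ↦ (S i , T i) in ℕ² whose steps are
-- diagonal, (±1 , ±1), send (i , j) to (p S i + q T j , q T i + p S j): a step of
-- i moves the image by (±p , ±q), a step of j by (±q , ±p).  If two vertices
-- collide, coprimality makes the S-gaps multiples of q and the T-gaps multiples
-- of p with crossed cofactors; as S + T has constant parity and p + q is odd,
-- both cofactors are even.  The walk is a boustrophedon through diagonal
-- translates of an L-shaped tile of 2pq cells, arranged so that points whose
-- S differ by a multiple of 2q have T less than 2p apart, which forces the
-- cofactors to vanish.  S grows like i / p and T stays bounded, so □_m fits
-- into a square of side m + O(q²).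
module Submission where

open import Defs
open import Data.Nat using (ℕ; zero; suc; pred; _+_; _*_; _∸_; _≤_; _<_; _%_; ∣_-_∣; _⊓_; z≤n; s≤s; s≤s⁻¹; z<s; NonZero; >-nonZero; _≤?_; _<?_; parity)
open import Data.Nat.Properties
open import Data.Nat.GCD using (gcd)
open import Data.Nat.Divisibility using (_∣_; _∤_; divides; ∣m+n∣m⇒∣n; ∣m∣n⇒∣m+n; m∣m*n; ∣n⇒∣m*n; *-monoˡ-∣; ∣1⇒≡1; ∣-refl; _∣0; n∣m⇒m%n≡0)
open import Data.Nat.DivMod using ([m+kn]%n≡m%n; m<n⇒m%n≡m)
open import Data.Nat.Coprimality using (Coprime; coprime-divisor; gcd≡1⇒coprime)
import Data.Nat.Coprimality as Coprime
open import Data.Nat.Primality using (euclidsLemma; prime[2])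
open import Data.Nat.Tactic.RingSolver using (solve-∀)
open import Data.Parity.Base using (Parity; 0ℙ; 1ℙ)
open import Data.Fin as Fin using (Fin; toℕ; fromℕ<; combine; remQuot)
open import Data.Fin.Properties using (remQuot-combine; combine-remQuot; combine-injective; any?; all?; injective⇒≤; toℕ-fromℕ<; toℕ-injective; toℕ<n)
open import Data.Product using (_×_; Σ; Σ-syntax; ∃-syntax; _,_; proj₁; proj₂; uncurry)
open import Data.Product.Properties using (≡-dec; ×-≡,≡→≡; ,-injective; ,-injectiveʳ)
open import Data.Sum as Sum using (_⊎_; inj₁; inj₂)
open import Data.Empty using (⊥-elim)
open import Function using (_∘_)
open import Function.Definitions using (Injective)
open import Relation.Binary.Definitions using (tri<; tri≈; tri>)
open import Relation.Binary.PropositionalEquality using (_≡_; _≢_; refl; sym; trans; cong; cong₂; subst; subst₂; _≗_; module ≡-Reasoning)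
open import Relation.Nullary using (Dec; yes; no; ¬_)
open import Relation.Nullary.Decidable using (_×-dec_; _⊎-dec_; _→-dec_; map′)
open import Relation.Unary using (Decidable)

-- Distances and parities in ℕ

∣m-n∣≡1⇒ : ∀ {m n} → ∣ m - n ∣ ≡ 1 → n ≡ suc m ⊎ m ≡ suc n
∣m-n∣≡1⇒ {zero} e = inj₁ e
∣m-n∣≡1⇒ {suc m} {zero} e = inj₂ e
∣m-n∣≡1⇒ {suc m} {suc n} e = Sum.map (cong suc) (cong suc) (∣m-n∣≡1⇒ e)

∣m-n∣≡k⇒ : ∀ {m n k} → ∣ m - n ∣ ≡ k → m ≡ n + k ⊎ n ≡ m + k
∣m-n∣≡k⇒ {m} {n} refl with ≤-total m n
... | inj₁ m≤n = inj₂ (trans (sym (m+[n∸m]≡n m≤n)) (cong (m +_) (sym (m≤n⇒∣m-n∣≡n∸m m≤n))))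
... | inj₂ n≤m = inj₁ (trans (sym (m+[n∸m]≡n n≤m)) (cong (n +_) (sym (m≤n⇒∣n-m∣≡n∸m n≤m))))

∣n-1+n∣≡1 : ∀ n → ∣ n - suc n ∣ ≡ 1
∣n-1+n∣≡1 zero = refl
∣n-1+n∣≡1 (suc n) = ∣n-1+n∣≡1 n

∣m+o-n+o∣≡∣m-n∣ : ∀ m n o → ∣ m + o - n + o ∣ ≡ ∣ m - n ∣
∣m+o-n+o∣≡∣m-n∣ m n o = trans (cong₂ ∣_-_∣ (+-comm m o) (+-comm n o)) (∣m+n-m+o∣≡∣n-o∣ o m n)

∣-∣-transfer : ∀ a b a′ b′ → a + b ≡ a′ + b′ → ∣ a - a′ ∣ ≡ ∣ b - b′ ∣
∣-∣-transfer a b a′ b′ e = begin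
  ∣ a - a′ ∣           ≡⟨ ∣m+o-n+o∣≡∣m-n∣ a a′ b ⟨
  ∣ a + b - a′ + b ∣   ≡⟨ cong ∣_- a′ + b ∣ e ⟩
  ∣ a′ + b′ - a′ + b ∣ ≡⟨ ∣m+n-m+o∣≡∣n-o∣ a′ b′ b ⟩
  ∣ b′ - b ∣           ≡⟨ ∣-∣-comm b′ b ⟩
  ∣ b - b′ ∣           ∎
  where open ≡-Reasoning

∣m-n∣+2[m⊓n]≡m+n : ∀ m n → ∣ m - n ∣ + 2 * (m ⊓ n) ≡ m + n
∣m-n∣+2[m⊓n]≡m+n zero n = +-identityʳ n
∣m-n∣+2[m⊓n]≡m+n (suc m) zero = refl
∣m-n∣+2[m⊓n]≡m+n (suc m) (suc n) = begin
  ∣ m - n ∣ + 2 * suc (m ⊓ n)       ≡⟨ shift ∣ m - n ∣ (m ⊓ n) ⟩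
  suc (suc (∣ m - n ∣ + 2 * (m ⊓ n))) ≡⟨ cong (suc ∘ suc) (∣m-n∣+2[m⊓n]≡m+n m n) ⟩
  suc (suc (m + n))                   ≡⟨ cong suc (+-suc m n) ⟨
  suc m + suc n                       ∎
  where
  open ≡-Reasoning
  shift : ∀ d k → d + 2 * suc k ≡ suc (suc (d + 2 * k))
  shift = solve-∀

unit-steps⇒∣-∣≡1 : (f : ℕ → ℕ) → (∀ i → ∣ f i - f (suc i) ∣ ≡ 1) → ∀ {i j} → ∣ i - j ∣ ≡ 1 → ∣ f i - f j ∣ ≡ 1
unit-steps⇒∣-∣≡1 f step {i} {j} e with ∣m-n∣≡1⇒ {i} {j} e
... | inj₁ refl = step i
... | inj₂ refl = trans (∣-∣-comm (f i) (f j)) (step j)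

∣-∣<-bound : ∀ {m n c} → m < n + c → n < m + c → ∣ m - n ∣ < c
∣-∣<-bound {m} {n} {c} m<n+c n<m+c with ∣m-n∣≡k⇒ {m} {n} refl
... | inj₁ m≡n+k = +-cancelˡ-< n _ c (subst (_< n + c) m≡n+k m<n+c)
... | inj₂ n≡m+k = +-cancelˡ-< m _ c (subst (_< m + c) n≡m+k n<m+c)

∣m∸n-m∸o∣≡∣n-o∣ : ∀ {m n o} → n ≤ m → o ≤ m → ∣ m ∸ n - m ∸ o ∣ ≡ ∣ n - o ∣
∣m∸n-m∸o∣≡∣n-o∣ {m} {n} {o} n≤m o≤m = ∣-∣-transfer (m ∸ n) n (m ∸ o) o (trans (m∸n+n≡m n≤m) (sym (m∸n+n≡m o≤m)))

+-*-unique : ∀ {d a b q q′} .{{_ : NonZero d}} → a < d → b < d → a + q * d ≡ b + q′ * d → a ≡ b × q ≡ q′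
+-*-unique {d} {a} {b} {q} {q′} a<d b<d e = a≡b , *-cancelʳ-≡ q q′ d (+-cancelˡ-≡ a _ _ (trans e (cong (_+ q′ * d) (sym a≡b))))
  where
  open ≡-Reasoning
  a≡b : a ≡ b
  a≡b = begin
    a                ≡⟨ m<n⇒m%n≡m a<d ⟨
    a % d            ≡⟨ [m+kn]%n≡m%n a q d ⟨
    (a + q * d) % d  ≡⟨ cong (_% d) e ⟩
    (b + q′ * d) % d ≡⟨ [m+kn]%n≡m%n b q′ d ⟩
    b % d            ≡⟨ m<n⇒m%n≡m b<d ⟩
    b                ∎

+-*-regroup : ∀ a k q d → a + k * d + q * d ≡ a + (k + q) * d
+-*-regroup a k q d = trans (+-assoc a _ _) (cong (a +_) (sym (*-distribʳ-+ d k q)))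

residues₀ : ∀ {d a a′} K → a < 2 * d → a ≡ a′ + K * d → a ≡ a′ ⊎ a ≡ a′ + d
residues₀ {d} {a} {a′} K a<2d e with *-cancelʳ-< d K 2 (≤-<-trans (subst (K * d ≤_) (sym e) (m≤n+m (K * d) a′)) a<2d)
... | s≤s z≤n = inj₁ (trans e (+-identityʳ a′))
... | s≤s (s≤s z≤n) = inj₂ (trans e (cong (a′ +_) (+-identityʳ d)))

residues : ∀ {d a a′} K K′ → a < 2 * d → a′ < 2 * d → a + K * d ≡ a′ + K′ * d → a ≡ a′ ⊎ a ≡ a′ + d ⊎ a′ ≡ a + d
residues {d} {a} {a′} (suc K) (suc K′) a<2d a′<2d e =
  residues K K′ a<2d a′<2d (+-cancelˡ-≡ d _ _ (trans (shift a K) (trans e (sym (shift a′ K′)))))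
  where
  shift : ∀ a K → d + (a + K * d) ≡ a + (d + K * d)
  shift a K = trans (sym (+-assoc d a _)) (trans (cong (_+ K * d) (+-comm d a)) (+-assoc a d _))
residues {a = a} zero K′ a<2d a′<2d e = Sum.map₂ inj₁ (residues₀ K′ a<2d (trans (sym (+-identityʳ a)) e))
residues {a′ = a′} (suc K) zero a<2d a′<2d e with residues₀ (suc K) a′<2d (sym (trans e (+-identityʳ a′)))
... | inj₁ a′≡a = inj₁ (sym a′≡a)
... | inj₂ a′≡a+d = inj₂ (inj₂ a′≡a+d)

odd-parity : ∀ n → 2 ∤ n → parity n ≡ 1ℙ
odd-parity zero 2∤0 = ⊥-elim (2∤0 (2 ∣0))
odd-parity (suc zero) _ = refl
odd-parity (suc (suc n)) 2∤2+n = odd-parity n (2∤2+n ∘ ∣m∣n⇒∣m+n ∣-refl)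

even-factor : ∀ {k n} → 2 ∤ n → 2 ∣ k * n → 2 ∣ k
even-factor {k} {n} 2∤n 2∣kn with euclidsLemma k n prime[2] 2∣kn
... | inj₁ 2∣k = 2∣k
... | inj₂ 2∣n = ⊥-elim (2∤n 2∣n)

-- The sum of the two numbers is (k₁ + k₂) (R + r), so k₁ + k₂ is even, and then
-- so is k₁ (R + r) = (k₁ R + r k₂) + r (k₁ + k₂) - 2 r k₂.
2∣-coefficient : ∀ R r → 2 ∤ R + r → ∀ k₁ k₂ → 2 ∣ k₁ * R + r * k₂ → 2 ∣ k₂ * R + r * k₁ → 2 ∣ k₁
2∣-coefficient R r odd k₁ k₂ e₁ e₂ = even-factor odd (∣m+n∣m⇒∣n 2∣sum′ (m∣m*n (r * k₂)))
  where
  2∣k₁+k₂ : 2 ∣ k₁ + k₂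
  2∣k₁+k₂ = even-factor odd (subst (2 ∣_) (sum k₁ k₂ R r) (∣m∣n⇒∣m+n e₁ e₂))
    where
    sum : ∀ k₁ k₂ R r → (k₁ * R + r * k₂) + (k₂ * R + r * k₁) ≡ (k₁ + k₂) * (R + r)
    sum = solve-∀
  2∣sum′ : 2 ∣ 2 * (r * k₂) + k₁ * (R + r)
  2∣sum′ = subst (2 ∣_) (sum′ k₁ k₂ R r) (∣m∣n⇒∣m+n e₁ (∣n⇒∣m*n r 2∣k₁+k₂))
    where
    sum′ : ∀ k₁ k₂ R r → (k₁ * R + r * k₂) + r * (k₁ + k₂) ≡ 2 * (r * k₂) + k₁ * (R + r)
    sum′ = solve-∀

even<2⇒≡0 : ∀ r {k} → 2 ∣ k → r * k < 2 * r → k ≡ 0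
even<2⇒≡0 r {k} 2∣k rk<2r with *-cancelˡ-< r k 2 (subst (r * k <_) (*-comm 2 r) rk<2r)
... | s≤s z≤n = refl
... | s≤s (s≤s z≤n) = ⊥-elim (1+n≢n (∣1⇒≡1 2∣k))

<∧≮1+⇒1+≡ : ∀ {m n} → m < n → ¬ suc m < n → suc m ≡ n
<∧≮1+⇒1+≡ m<n 1+m≮n = ≤-antisym m<n (≮⇒≥ 1+m≮n)

-- Deciding embeddability and the maximal grid

Searchable : Set → Set₁
Searchable A = (P : A → Set) → Decidable P → Dec (∃[ a ] P a)

×-searchable : ∀ {A B} → Searchable A → Searchable B → Searchable (A × B)
×-searchable search-A search-B P P? =
  map′ (λ (a , b , pab) → (a , b) , pab) (λ ((a , b) , pab) → a , b , pab)
       (search-A (λ a → ∃[ b ] P (a , b)) (λ a → search-B (P ∘ (a ,_)) (P? ∘ (a ,_))))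

-- Only predicates invariant under pointwise equality can be searched, as
-- function extensionality is not available.
Π-search : ∀ k {B} → Searchable B → (P : (Fin k → B) → Set) →
  (∀ {f g} → f ≗ g → P f → P g) → Decidable P → Dec (∃[ f ] P f)
Π-search zero {B} search-B P resp P? =
  map′ (λ p → none , p) (λ (f , pf) → resp {f} (λ ()) pf) (P? none)
  where
  none : Fin 0 → B
  none ()
Π-search (suc k) {B} search-B P resp P? =
  map′ (λ (b , f , pf) → cons b f , pf)
       (λ (f , pf) → f Fin.zero , f ∘ Fin.suc , resp cons-head-tail pf)
       (search-B (λ b → ∃[ f ] P (cons b f))
         (λ b → Π-search k search-B (P ∘ cons b) (λ f≗g → resp (cons-cong b f≗g)) (P? ∘ cons b)))
  where
  cons : B → (Fin k → B) → Fin (suc k) → B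
  cons b f Fin.zero = b
  cons b f (Fin.suc i) = f i
  cons-cong : ∀ b {f g} → f ≗ g → cons b f ≗ cons b g
  cons-cong b f≗g Fin.zero = refl
  cons-cong b f≗g (Fin.suc i) = f≗g i
  cons-head-tail : ∀ {f} → f ≗ cons (f Fin.zero) (f ∘ Fin.suc)
  cons-head-tail Fin.zero = refl
  cons-head-tail (Fin.suc i) = refl

vertex-searchable : ∀ n → Searchable (Vertex n)
vertex-searchable n = ×-searchable (λ _ → any?) (λ _ → any?)

∀-vertex? : ∀ {m} {P : Vertex m → Set} → Decidable P → Dec (∀ v → P v)
∀-vertex? P? = map′ (λ h (i , j) → h i j) (λ h i j → h (i , j)) (all? λ i → all? λ j → P? (i , j))

IsGridEmbedding : (p q m n : ℕ) → (Vertex m → Vertex n) → Set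
IsGridEmbedding p q m n f =
  Injective _≡_ _≡_ f × (∀ u v → GridAdj m u v → LeaperAdj p q n (f u) (f v))

isGridEmbedding? : ∀ p q m n → Decidable (IsGridEmbedding p q m n)
isGridEmbedding? p q m n f =
  map′ (λ h {u} {v} → h u v) (λ inj u v → inj)
       (∀-vertex? λ u → ∀-vertex? λ v → vertex-≟ (f u) (f v) →-dec vertex-≟ u v)
  ×-dec ∀-vertex? λ u → ∀-vertex? λ v → gridAdj? u v →-dec leaperAdj? (f u) (f v)
  where
  vertex-≟ : ∀ {k} (u v : Vertex k) → Dec (u ≡ v)
  vertex-≟ = ≡-dec Fin._≟_ Fin._≟_
  gridAdj? : ∀ u v → Dec (GridAdj m u v)
  gridAdj? u v = ((dx u v ≟ 1) ×-dec (dy u v ≟ 0)) ⊎-dec ((dx u v ≟ 0) ×-dec (dy u v ≟ 1))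
  leaperAdj? : ∀ u v → Dec (LeaperAdj p q n u v)
  leaperAdj? u v = ((dx u v ≟ p) ×-dec (dy u v ≟ q)) ⊎-dec ((dx u v ≟ q) ×-dec (dy u v ≟ p))

isGridEmbedding-resp : ∀ {p q m n f g} → f ≗ g → IsGridEmbedding p q m n f → IsGridEmbedding p q m n g
isGridEmbedding-resp {p} {q} {m} {n} f≗g (inj , adj) =
  (λ {u} {v} e → inj (trans (f≗g u) (trans e (sym (f≗g v))))) ,
  (λ u v uv → subst₂ (LeaperAdj p q n) (f≗g u) (f≗g v) (adj u v uv))

-- Π-search needs a domain Fin k, hence the detour through Fin (m * m) ≅ Vertex m.
gridEmbedsLeaper? : ∀ p q m n → Dec (GridEmbedsLeaper p q m n)
gridEmbedsLeaper? p q m n =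
  map′ (λ (F , emb) → F ∘ uncurry combine , emb)
       (λ (f , emb) → f ∘ remQuot {m} m , isGridEmbedding-resp (λ v → cong f (sym (remQuot-combine′ v))) emb)
       (Π-search (m * m) (vertex-searchable n) (λ F → IsGridEmbedding p q m n (F ∘ uncurry combine))
         (λ F≗G → isGridEmbedding-resp (F≗G ∘ uncurry combine))
         (λ F → isGridEmbedding? p q m n (F ∘ uncurry combine)))
  where
  remQuot-combine′ : ∀ (v : Vertex m) → remQuot {m} m (uncurry combine v) ≡ v
  remQuot-combine′ (i , j) = remQuot-combine i j

gridEmbedsLeaper⇒≤ : ∀ {p q m n} → GridEmbedsLeaper p q m n → m ≤ n
gridEmbedsLeaper⇒≤ {m = m} {n} (f , f-inj , _) =
  ≮⇒≥ λ n<m → <⇒≱ (*-mono-< n<m n<m) (injective⇒≤ {f = flatten} flatten-inj)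
  where
  flatten : Fin (m * m) → Fin (n * n)
  flatten = uncurry combine ∘ f ∘ remQuot {m} m
  flatten-inj : Injective _≡_ _≡_ flatten
  flatten-inj {i} {j} e = begin
    i                                 ≡⟨ combine-remQuot {m} m i ⟨
    uncurry combine (remQuot {m} m i) ≡⟨ cong (uncurry combine) (f-inj (×-≡,≡→≡ (combine-injective _ _ _ _ e))) ⟩
    uncurry combine (remQuot {m} m j) ≡⟨ combine-remQuot {m} m j ⟩
    j                                 ∎
    where open ≡-Reasoning

singleton-embeds : ∀ p q n → 1 ≤ n → GridEmbedsLeaper p q 1 n
singleton-embeds p q (suc n) _ = (λ _ → Fin.zero , Fin.zero) , (λ _ → one-vertex) , no-edges
  where
  one-vertex : ∀ {u v : Vertex 1} → u ≡ v
  one-vertex {Fin.zero , Fin.zero} {Fin.zero , Fin.zero} = refl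
  no-edges : ∀ u v → GridAdj 1 u v → _
  no-edges (Fin.zero , Fin.zero) (Fin.zero , Fin.zero) (inj₁ (() , _))
  no-edges (Fin.zero , Fin.zero) (Fin.zero , Fin.zero) (inj₂ (_ , ()))

largest : ∀ {P : ℕ → Set} → Decidable P → ∀ n → (∀ m → P m → m ≤ n) → ∀ {k} → P k →
  Σ[ m ∈ ℕ ] P m × (∀ m′ → P m′ → m′ ≤ m)
largest P? n bound pk with P? n
... | yes pn = n , pn , bound
largest P? zero bound {k} pk | no ¬pn with bound k pk
... | z≤n = ⊥-elim (¬pn pk)
largest {P} P? (suc n) bound pk | no ¬pn = largest P? n bound′ pk
  where
  bound′ : ∀ m → P m → m ≤ n
  bound′ m pm = s≤s⁻¹ (≤∧≢⇒< (bound m pm) λ { refl → ¬pn pm })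

near-maximum : ∀ p q C → (∀ m n → m + C ≤ n → GridEmbedsLeaper p q m n) →
  ∀ n → 1 ≤ n → Σ[ m ∈ ℕ ] IsMaxGrid p q n m × ∣ m - n ∣ ≤ C
near-maximum p q C near-full n 1≤n with largest (λ m → gridEmbedsLeaper? p q m n) n (λ m → gridEmbedsLeaper⇒≤) (singleton-embeds p q n 1≤n)
... | m , embeds , maximal =
  m , (maximal 1 (singleton-embeds p q n 1≤n) , embeds , λ m′ _ → maximal m′) ,
  subst (_≤ C) (sym (m≤n⇒∣m-n∣≡n∸m (gridEmbedsLeaper⇒≤ embeds))) (m≤n+o⇒m∸n≤o n m (n≤m+C))
  where
  n≤m+C : n ≤ m + C
  n≤m+C with C ≤? n
  ... | yes C≤n = ≤-trans (≤-reflexive (sym (m∸n+n≡m C≤n))) (+-monoˡ-≤ C (maximal (n ∸ C) (near-full (n ∸ C) n (≤-reflexive (m∸n+n≡m C≤n)))))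
  ... | no C≰n = ≤-trans (<⇒≤ (≰⇒> C≰n)) (m≤n+m C m)

-- Embeddings from diagonal walks

record DiagonalWalk (r R : ℕ) : Set where
  field
    S T : ℕ → ℕ
    S-step : ∀ i → ∣ S i - S (suc i) ∣ ≡ 1
    T-step : ∀ i → ∣ T i - T (suc i) ∣ ≡ 1
    sum-parity : ∀ i j → 2 ∣ (S i + T i) + (S j + T j)
    injective : ∀ {i j} → S i ≡ S j → T i ≡ T j → i ≡ j
    T-close : ∀ i j → 2 * R ∣ ∣ S i - S j ∣ → ∣ T i - T j ∣ < 2 * r
    spread : ℕ
    bounded : ∀ i j → r * S i + R * T j ≤ i + spread

module WalkEmbedding {r R} (walk : DiagonalWalk r R) .{{_ : NonZero R}} (coprime : Coprime r R) (odd : 2 ∤ R + r) where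

  open DiagonalWalk walk

  X : ℕ → ℕ → ℕ
  X i j = r * S i + R * T j

  even-displacement : ∀ a a′ → 2 ∣ ∣ S a - S a′ ∣ + ∣ T a - T a′ ∣
  even-displacement a a′ = ∣m+n∣m⇒∣n (subst (2 ∣_) rearrange (sum-parity a a′)) (m∣m*n (S a ⊓ S a′ + T a ⊓ T a′))
    where
    open ≡-Reasoning
    rearrange : (S a + T a) + (S a′ + T a′) ≡ 2 * (S a ⊓ S a′ + T a ⊓ T a′) + (∣ S a - S a′ ∣ + ∣ T a - T a′ ∣)
    rearrange = begin
      (S a + T a) + (S a′ + T a′) ≡⟨ shuffle (S a) (T a) (S a′) (T a′) ⟩
      (S a + S a′) + (T a + T a′) ≡⟨ cong₂ _+_ (∣m-n∣+2[m⊓n]≡m+n (S a) (S a′)) (∣m-n∣+2[m⊓n]≡m+n (T a) (T a′)) ⟨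
      (∣ S a - S a′ ∣ + 2 * (S a ⊓ S a′)) + (∣ T a - T a′ ∣ + 2 * (T a ⊓ T a′)) ≡⟨ shuffle′ ∣ S a - S a′ ∣ (S a ⊓ S a′) ∣ T a - T a′ ∣ (T a ⊓ T a′) ⟩
      2 * (S a ⊓ S a′ + T a ⊓ T a′) + (∣ S a - S a′ ∣ + ∣ T a - T a′ ∣) ∎
      where
      shuffle : ∀ a b c d → (a + b) + (c + d) ≡ (a + c) + (b + d)
      shuffle = solve-∀
      shuffle′ : ∀ d₁ m₁ d₂ m₂ → (d₁ + 2 * m₁) + (d₂ + 2 * m₂) ≡ 2 * (m₁ + m₂) + (d₁ + d₂)
      shuffle′ = solve-∀

  collision-gaps : ∀ {a b a′ b′} → X a b ≡ X a′ b′ → ∃[ k ] ∣ S a - S a′ ∣ ≡ k * R × ∣ T b - T b′ ∣ ≡ r * k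
  collision-gaps {a} {b} {a′} {b′} e with coprime-divisor (Coprime.sym coprime) (divides ∣ T b - T b′ ∣ r∣ΔS∣≡R∣ΔT∣′)
    where
    r∣ΔS∣≡R∣ΔT∣′ : r * ∣ S a - S a′ ∣ ≡ ∣ T b - T b′ ∣ * R
    r∣ΔS∣≡R∣ΔT∣′ = trans (*-distribˡ-∣-∣ r (S a) (S a′)) (trans (∣-∣-transfer (r * S a) (R * T b) (r * S a′) (R * T b′) e)
                     (trans (sym (*-distribˡ-∣-∣ R (T b) (T b′))) (*-comm R _)))
  ... | divides k ∣ΔS∣≡kR = k , ∣ΔS∣≡kR , *-cancelˡ-≡ _ _ R (begin
      R * ∣ T b - T b′ ∣    ≡⟨ *-distribˡ-∣-∣ R (T b) (T b′) ⟩
      ∣ R * T b - R * T b′ ∣ ≡⟨ ∣-∣-transfer (r * S a) (R * T b) (r * S a′) (R * T b′) e ⟨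
      ∣ r * S a - r * S a′ ∣ ≡⟨ *-distribˡ-∣-∣ r (S a) (S a′) ⟨
      r * ∣ S a - S a′ ∣     ≡⟨ cong (r *_) ∣ΔS∣≡kR ⟩
      r * (k * R)            ≡⟨ swap r k R ⟩
      R * (r * k)            ∎)
    where
    open ≡-Reasoning
    swap : ∀ r k R → r * (k * R) ≡ R * (r * k)
    swap = solve-∀

  X-injectiveˡ : ∀ {a b a′ b′} → X a b ≡ X a′ b′ → X b a ≡ X b′ a′ → a ≡ a′
  X-injectiveˡ {a} {b} {a′} {b′} e e′ with collision-gaps e | collision-gaps e′
  ... | k₁ , ∣ΔSa∣≡k₁R , ∣ΔTb∣≡rk₁ | k₂ , ∣ΔSb∣≡k₂R , ∣ΔTa∣≡rk₂ =
    injective (∣m-n∣≡0⇒m≡n (trans ∣ΔSa∣≡k₁R (cong (_* R) k₁≡0)))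
              (∣m-n∣≡0⇒m≡n (trans ∣ΔTa∣≡rk₂ (trans (cong (r *_) k₂≡0) (*-zeroʳ r))))
    where
    even-a : 2 ∣ k₁ * R + r * k₂
    even-a = subst (2 ∣_) (cong₂ _+_ ∣ΔSa∣≡k₁R ∣ΔTa∣≡rk₂) (even-displacement a a′)
    even-b : 2 ∣ k₂ * R + r * k₁
    even-b = subst (2 ∣_) (cong₂ _+_ ∣ΔSb∣≡k₂R ∣ΔTb∣≡rk₁) (even-displacement b b′)
    2∣k₁ : 2 ∣ k₁
    2∣k₁ = 2∣-coefficient R r odd k₁ k₂ even-a even-b
    2∣k₂ : 2 ∣ k₂
    2∣k₂ = 2∣-coefficient R r odd k₂ k₁ even-b even-a
    k₂≡0 : k₂ ≡ 0
    k₂≡0 = even<2⇒≡0 r 2∣k₂ (subst (_< 2 * r) ∣ΔTa∣≡rk₂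
             (T-close a a′ (subst (2 * R ∣_) (sym ∣ΔSa∣≡k₁R) (*-monoˡ-∣ R 2∣k₁))))
    k₁≡0 : k₁ ≡ 0
    k₁≡0 = even<2⇒≡0 r 2∣k₁ (subst (_< 2 * r) ∣ΔTb∣≡rk₁
             (T-close b b′ (subst (2 * R ∣_) (sym ∣ΔSb∣≡k₂R) (*-monoˡ-∣ R 2∣k₂))))

  X-stepˡ : ∀ {a a′} b → ∣ a - a′ ∣ ≡ 1 → ∣ X a b - X a′ b ∣ ≡ r
  X-stepˡ {a} {a′} b e = begin
    ∣ X a b - X a′ b ∣     ≡⟨ ∣m+o-n+o∣≡∣m-n∣ (r * S a) (r * S a′) (R * T b) ⟩
    ∣ r * S a - r * S a′ ∣ ≡⟨ *-distribˡ-∣-∣ r (S a) (S a′) ⟨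
    r * ∣ S a - S a′ ∣     ≡⟨ cong (r *_) (unit-steps⇒∣-∣≡1 S S-step e) ⟩
    r * 1                  ≡⟨ *-identityʳ r ⟩
    r                      ∎
    where open ≡-Reasoning

  X-stepʳ : ∀ a {b b′} → ∣ b - b′ ∣ ≡ 1 → ∣ X a b - X a b′ ∣ ≡ R
  X-stepʳ a {b} {b′} e = begin
    ∣ X a b - X a b′ ∣     ≡⟨ ∣m+n-m+o∣≡∣n-o∣ (r * S a) (R * T b) (R * T b′) ⟩
    ∣ R * T b - R * T b′ ∣ ≡⟨ *-distribˡ-∣-∣ R (T b) (T b′) ⟨
    R * ∣ T b - T b′ ∣     ≡⟨ cong (R *_) (unit-steps⇒∣-∣≡1 T T-step e) ⟩
    R * 1                  ≡⟨ *-identityʳ R ⟩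
    R                      ∎
    where open ≡-Reasoning

  walk-embeds : ∀ m n → m + spread ≤ n → GridEmbedsLeaper r R m n
  walk-embeds m n m+spread≤n = embed , embed-injective , embed-adjacent
    where
    X<n : (i j : Fin m) → X (toℕ i) (toℕ j) < n
    X<n i j = <-≤-trans (≤-<-trans (bounded (toℕ i) (toℕ j)) (+-monoˡ-< spread (toℕ<n i))) m+spread≤n
    coord : Fin m → Fin m → Fin n
    coord i j = fromℕ< (X<n i j)
    toℕ-coord : ∀ i j → toℕ (coord i j) ≡ X (toℕ i) (toℕ j)
    toℕ-coord i j = toℕ-fromℕ< (X<n i j)
    embed : Vertex m → Vertex n
    embed (i , j) = coord i j , coord j i
    embed-injective : Injective _≡_ _≡_ embed
    embed-injective {i , j} {i′ , j′} e =
      ×-≡,≡→≡ (toℕ-injective (X-injectiveˡ X≡ X≡′) , toℕ-injective (X-injectiveˡ X≡′ X≡))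
      where
      X≡ : X (toℕ i) (toℕ j) ≡ X (toℕ i′) (toℕ j′)
      X≡ = trans (sym (toℕ-coord i j)) (trans (cong (toℕ ∘ proj₁) e) (toℕ-coord i′ j′))
      X≡′ : X (toℕ j) (toℕ i) ≡ X (toℕ j′) (toℕ i′)
      X≡′ = trans (sym (toℕ-coord j i)) (trans (cong (toℕ ∘ proj₂) e) (toℕ-coord j′ i′))
    embed-adjacent : ∀ u v → GridAdj m u v → LeaperAdj r R n (embed u) (embed v)
    embed-adjacent (i , j) (i′ , j′) (inj₁ (∣Δi∣≡1 , ∣Δj∣≡0)) with toℕ-injective {i = j} {j′} (∣m-n∣≡0⇒m≡n ∣Δj∣≡0)
    ... | refl = inj₁ (trans (cong₂ ∣_-_∣ (toℕ-coord i j) (toℕ-coord i′ j)) (X-stepˡ (toℕ j) ∣Δi∣≡1) ,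
                       trans (cong₂ ∣_-_∣ (toℕ-coord j i) (toℕ-coord j i′)) (X-stepʳ (toℕ j) ∣Δi∣≡1))
    embed-adjacent (i , j) (i′ , j′) (inj₂ (∣Δi∣≡0 , ∣Δj∣≡1)) with toℕ-injective {i = i} {i′} (∣m-n∣≡0⇒m≡n ∣Δi∣≡0)
    ... | refl = inj₂ (trans (cong₂ ∣_-_∣ (toℕ-coord i j) (toℕ-coord i j′)) (X-stepʳ (toℕ i) ∣Δj∣≡1) ,
                       trans (cong₂ ∣_-_∣ (toℕ-coord j i) (toℕ-coord j′ i)) (X-stepˡ (toℕ i) ∣Δj∣≡1))

-- The staircase walk

module Staircase (r R : ℕ) (1≤r : 1 ≤ r) (r<R : r < R) (odd : 2 ∤ R + r) where

  instance
    R-nonZero : NonZero R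
    R-nonZero = >-nonZero (≤-<-trans z≤n r<R)

  -- A cell (k , u , v) is the point (u , v) of the k-th copy of the tile,
  -- the L-shape [0 , R + r) × [0 , r) ∪ [R , R + r) × [0 , R); copy k is the
  -- translate by (k R , k R), i.e. by (2 k R , 0) in the rotated coordinates
  -- S = u + v, T = u - v + R.
  Cell : Set
  Cell = ℕ × ℕ × ℕ

  data InTile : Cell → Set where
    in-tile : ∀ {k u v} → u < R + r → v < R → v < r ⊎ R ≤ u → InTile (k , u , v)

  cellS : Cell → ℕ
  cellS (k , u , v) = u + v + k * (2 * R)

  cellT : Cell → ℕ
  cellT (_ , u , v) = u + (R ∸ v)

  cellT+antidiagonal : ∀ {k u v} → v ≤ R → cellT (k , u , v) + (u + v) ≡ 2 * u + R
  cellT+antidiagonal {u = u} {v} v≤R =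
    trans (rearrange u (R ∸ v) v) (cong (2 * u +_) (m∸n+n≡m v≤R))
    where
    rearrange : ∀ u x v → u + x + (u + v) ≡ 2 * u + (x + v)
    rearrange = solve-∀

  cell-parity : ∀ {c} → InTile c → ∃[ a ] cellS c + cellT c ≡ 2 * a + R
  cell-parity {k , u , v} (in-tile _ v<R _) = u + k * R , (begin
    u + v + k * (2 * R) + cellT (k , u , v)   ≡⟨ rearrange (u + v) k R (cellT (k , u , v)) ⟩
    cellT (k , u , v) + (u + v) + 2 * (k * R) ≡⟨ cong (_+ 2 * (k * R)) (cellT+antidiagonal {k} {u} (<⇒≤ v<R)) ⟩
    2 * u + R + 2 * (k * R)                   ≡⟨ rearrange′ u R (k * R) ⟩
    2 * (u + k * R) + R                       ∎)
    where
    open ≡-Reasoning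
    rearrange : ∀ a k R t → a + k * (2 * R) + t ≡ t + a + 2 * (k * R)
    rearrange = solve-∀
    rearrange′ : ∀ u R kR → 2 * u + R + 2 * kR ≡ 2 * (u + kR) + R
    rearrange′ = solve-∀

  cell-injective : ∀ {c c′} → InTile c → InTile c′ → cellS c ≡ cellS c′ → cellT c ≡ cellT c′ → c ≡ c′
  cell-injective {k , u , v} {k′ , u′ , v′} tile@(in-tile _ v<R _) tile′@(in-tile _ v′<R _) S≡ T≡ =
    cong₂ _,_ k≡k′ (cong₂ _,_ u≡u′ v≡v′)
    where
    split : ∀ u v k R → u + v + k * (2 * R) ≡ (u + k * R) + (v + k * R)
    split = solve-∀
    u+kR≡ : u + k * R ≡ u′ + k′ * R
    u+kR≡ = *-cancelˡ-≡ _ _ 2 (+-cancelʳ-≡ R _ _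
      (trans (sym (proj₂ (cell-parity {k , u , v} tile))) (trans (cong₂ _+_ S≡ T≡) (proj₂ (cell-parity {k′ , u′ , v′} tile′)))))
    v+kR≡ : v + k * R ≡ v′ + k′ * R
    v+kR≡ = +-cancelˡ-≡ (u + k * R) _ _ (trans (sym (split u v k R))
      (trans S≡ (trans (split u′ v′ k′ R) (cong (_+ (v′ + k′ * R)) (sym u+kR≡)))))
    v≡v′ : v ≡ v′
    v≡v′ = proj₁ (+-*-unique {q = k} {k′} v<R v′<R v+kR≡)
    k≡k′ : k ≡ k′
    k≡k′ = proj₂ (+-*-unique {q = k} {k′} v<R v′<R v+kR≡)
    u≡u′ : u ≡ u′
    u≡u′ = +-cancelʳ-≡ (k * R) u u′ (trans u+kR≡ (cong (λ k → u′ + k * R) (sym k≡k′)))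

  cellT≤ : ∀ {c} → InTile c → cellT c ≤ 2 * R + r
  cellT≤ {_ , u , v} (in-tile u<R+r _ _) = begin
    u + (R ∸ v) ≤⟨ +-mono-≤ (<⇒≤ u<R+r) (m∸n≤m R v) ⟩
    R + r + R   ≡⟨ rearrange R r ⟩
    2 * R + r   ∎
    where
    open ≤-Reasoning
    rearrange : ∀ R r → R + r + R ≡ 2 * R + r
    rearrange = solve-∀

  antidiagonal-spread : ∀ {k u v k′ u′ v′} → InTile (k , u , v) → InTile (k′ , u′ , v′) → u + v ≡ u′ + v′ → u < u′ + r
  antidiagonal-spread {u = u} {v} {u′ = u′} {v′} _ (in-tile _ _ (inj₁ v′<r)) e =
    ≤-<-trans (subst (u ≤_) e (m≤m+n u v)) (+-monoʳ-< u′ v′<r)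
  antidiagonal-spread (in-tile u<R+r _ _) (in-tile _ _ (inj₂ R≤u′)) _ = <-≤-trans u<R+r (+-monoˡ-≤ r R≤u′)

  antidiagonal-wrap : ∀ {k u v k′ u′ v′} → InTile (k , u , v) → InTile (k′ , u′ , v′) →
    u + v ≡ u′ + v′ + 2 * R → u′ + R < u + r × u < u′ + R + r
  antidiagonal-wrap {u = u} {v} {u′ = u′} {v′} (in-tile u<R+r v<R _) _ e =
    ≤-<-trans (+-monoˡ-≤ R (m≤m+n u′ v′)) (<-≤-trans u′+v′+R<u (m≤m+n u r)) ,
    <-≤-trans u<R+r (+-monoˡ-≤ r (m≤n+m R u′))
    where
    u′+v′+R<u : u′ + v′ + R < u
    u′+v′+R<u = +-cancelʳ-< R _ u (begin-strict
      u′ + v′ + R + R     ≡⟨ +-assoc (u′ + v′) R R ⟩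
      u′ + v′ + (R + R)   ≡⟨ cong (u′ + v′ +_) (cong (R +_) (+-identityʳ R)) ⟨
      u′ + v′ + 2 * R     ≡⟨ e ⟨
      u + v               <⟨ +-monoʳ-< u v<R ⟩
      u + R               ∎)
      where open ≤-Reasoning

  cellT-gap : ∀ {k u v k′ u′ v′} c c′ → v ≤ R → v′ ≤ R → u + v + 2 * c ≡ u′ + v′ + 2 * c′ →
    ∣ cellT (k , u , v) - cellT (k′ , u′ , v′) ∣ ≡ 2 * ∣ u + c - u′ + c′ ∣
  cellT-gap {k} {u} {v} {k′} {u′} {v′} c c′ v≤R v′≤R e = begin
    ∣ cellT (k , u , v) - cellT (k′ , u′ , v′) ∣                         ≡⟨ ∣m+o-n+o∣≡∣m-n∣ (cellT (k , u , v)) (cellT (k′ , u′ , v′)) A ⟨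
    ∣ cellT (k , u , v) + A - cellT (k′ , u′ , v′) + A ∣                 ≡⟨ cong₂ ∣_-_∣ (shifted k u v c v≤R) (trans (cong (cellT (k′ , u′ , v′) +_) e) (shifted k′ u′ v′ c′ v′≤R)) ⟩
    ∣ 2 * (u + c) + R - 2 * (u′ + c′) + R ∣                             ≡⟨ ∣m+o-n+o∣≡∣m-n∣ (2 * (u + c)) (2 * (u′ + c′)) R ⟩
    ∣ 2 * (u + c) - 2 * (u′ + c′) ∣                                     ≡⟨ *-distribˡ-∣-∣ 2 (u + c) (u′ + c′) ⟨
    2 * ∣ u + c - u′ + c′ ∣                                             ∎
    where
    open ≡-Reasoning
    A : ℕ
    A = u + v + 2 * c
    shifted : ∀ k u v c → v ≤ R → cellT (k , u , v) + (u + v + 2 * c) ≡ 2 * (u + c) + R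
    shifted k u v c v≤R = begin
      cellT (k , u , v) + (u + v + 2 * c)   ≡⟨ +-assoc (cellT (k , u , v)) (u + v) (2 * c) ⟨
      cellT (k , u , v) + (u + v) + 2 * c   ≡⟨ cong (_+ 2 * c) (cellT+antidiagonal {k} {u} v≤R) ⟩
      2 * u + R + 2 * c                     ≡⟨ rearrange u R c ⟩
      2 * (u + c) + R                       ∎
      where
      rearrange : ∀ u R c → 2 * u + R + 2 * c ≡ 2 * (u + c) + R
      rearrange = solve-∀

  antidiagonal<4R : ∀ {k u v} → InTile (k , u , v) → u + v < 2 * (2 * R)
  antidiagonal<4R {u = u} {v} (in-tile u<R+r v<R _) = begin-strict
    u + v               <⟨ +-mono-< u<R+r v<R ⟩
    R + r + R           ≤⟨ +-monoˡ-≤ R (+-monoʳ-≤ R (<⇒≤ r<R)) ⟩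
    R + R + R           ≤⟨ m≤m+n (R + R + R) R ⟩
    R + R + R + R       ≡⟨ four R ⟩
    2 * (2 * R)         ∎
    where
    open ≤-Reasoning
    four : ∀ R → R + R + R + R ≡ 2 * (2 * R)
    four = solve-∀

  congruent-antidiagonals : ∀ {k u v k′ u′ v′} → InTile (k , u , v) → InTile (k′ , u′ , v′) →
    2 * R ∣ ∣ cellS (k , u , v) - cellS (k′ , u′ , v′) ∣ →
    u + v ≡ u′ + v′ ⊎ u + v ≡ u′ + v′ + 2 * R ⊎ u′ + v′ ≡ u + v + 2 * R
  congruent-antidiagonals {k} {u} {v} {k′} {u′} {v′} tile tile′ (divides q ∣ΔS∣≡q2R) with ∣m-n∣≡k⇒ ∣ΔS∣≡q2R
  ... | inj₁ S≡S′+q2R = residues k (k′ + q) (antidiagonal<4R tile) (antidiagonal<4R tile′) (trans S≡S′+q2R (+-*-regroup (u′ + v′) k′ q (2 * R)))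
  ... | inj₂ S′≡S+q2R with residues k′ (k + q) (antidiagonal<4R tile′) (antidiagonal<4R tile) (trans S′≡S+q2R (+-*-regroup (u + v) k q (2 * R)))
  ...   | inj₁ a′≡a = inj₁ (sym a′≡a)
  ...   | inj₂ (inj₁ a′≡a+2R) = inj₂ (inj₂ a′≡a+2R)
  ...   | inj₂ (inj₂ a≡a′+2R) = inj₂ (inj₁ a≡a′+2R)

  InTile⇒v≤R : ∀ {k u v} → InTile (k , u , v) → v ≤ R
  InTile⇒v≤R (in-tile _ v<R _) = <⇒≤ v<R

  T-gap<2r : ∀ t t′ {x y} → ∣ t - t′ ∣ ≡ 2 * ∣ x - y ∣ → x < y + r → y < x + r → ∣ t - t′ ∣ < 2 * r
  T-gap<2r t t′ gap x<y+r y<x+r = subst (_< 2 * r) (sym gap) (*-monoʳ-< 2 (∣-∣<-bound x<y+r y<x+r))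

  T-close-aligned : ∀ {k u v k′ u′ v′} → InTile (k , u , v) → InTile (k′ , u′ , v′) → u + v ≡ u′ + v′ →
    ∣ cellT (k , u , v) - cellT (k′ , u′ , v′) ∣ < 2 * r
  T-close-aligned {k} {u} {v} {k′} {u′} {v′} tile tile′ e =
    T-gap<2r (cellT (k , u , v)) (cellT (k′ , u′ , v′)) (trans (cellT-gap {k} {u} {v} {k′} 0 0 (InTile⇒v≤R tile) (InTile⇒v≤R tile′) (cong (_+ 0) e))
                    (cong (2 *_) (cong₂ ∣_-_∣ (+-identityʳ u) (+-identityʳ u′))))
             (antidiagonal-spread tile tile′ e) (antidiagonal-spread tile′ tile (sym e))

  T-close-wrapped : ∀ {k u v k′ u′ v′} → InTile (k , u , v) → InTile (k′ , u′ , v′) → u + v ≡ u′ + v′ + 2 * R →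
    ∣ cellT (k , u , v) - cellT (k′ , u′ , v′) ∣ < 2 * r
  T-close-wrapped {k} {u} {v} {k′} {u′} {v′} tile tile′ e =
    T-gap<2r (cellT (k , u , v)) (cellT (k′ , u′ , v′)) (trans (cellT-gap {k} {u} {v} {k′} 0 R (InTile⇒v≤R tile) (InTile⇒v≤R tile′) (trans (+-identityʳ (u + v)) e))
                    (cong (λ x → 2 * ∣ x - _ ∣) (+-identityʳ u)))
             (proj₂ (antidiagonal-wrap tile tile′ e)) (proj₁ (antidiagonal-wrap tile tile′ e))

  -- Cells whose S agree modulo 2 R lie on one antidiagonal or on two antidiagonals
  -- 2 R apart; the shape of the tile keeps their u (shifted by R in the second
  -- case) less than r apart, and T is 2 u up to the antidiagonal.
  cell-T-close : ∀ {c c′} → InTile c → InTile c′ → 2 * R ∣ ∣ cellS c - cellS c′ ∣ → ∣ cellT c - cellT c′ ∣ < 2 * r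
  cell-T-close {k , u , v} {k′ , u′ , v′} tile tile′ 2R∣ΔS with congruent-antidiagonals tile tile′ 2R∣ΔS
  ... | inj₁ a≡a′ = T-close-aligned tile tile′ a≡a′
  ... | inj₂ (inj₁ a≡a′+2R) = T-close-wrapped tile tile′ a≡a′+2R
  ... | inj₂ (inj₂ a′≡a+2R) =
    subst (_< 2 * r) (∣-∣-comm (cellT (k′ , u′ , v′)) (cellT (k , u , v))) (T-close-wrapped tile′ tile a′≡a+2R)

  along : Parity → ℕ → ℕ
  along 0ℙ t = t
  along 1ℙ t = r ∸ suc t

  along-< : ∀ p {t} → t < r → along p t < r
  along-< 0ℙ t<r = t<r
  along-< 1ℙ t<r = ∸-monoʳ-< {o = 0} z<s t<r

  along≤R : ∀ p {t} → t < r → along p t ≤ R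
  along≤R p t<r = <⇒≤ (<-trans (along-< p t<r) r<R)

  along-injective : ∀ p {t t′} → t < r → t′ < r → along p t ≡ along p t′ → t ≡ t′
  along-injective 0ℙ _ _ e = e
  along-injective 1ℙ t<r t′<r e = suc-injective (∸-cancelˡ-≡ t<r t′<r e)

  along-step : ∀ p {t} → suc t < r → ∣ along p t - along p (suc t) ∣ ≡ 1
  along-step 0ℙ {t} _ = ∣n-1+n∣≡1 t
  along-step 1ℙ {t} t+2≤r = trans (∣m∸n-m∸o∣≡∣n-o∣ (<⇒≤ t+2≤r) t+2≤r) (∣n-1+n∣≡1 (suc t))

  along-turn : ∀ n {t} → suc t ≡ r → along (parity n) t ≡ along (parity (suc n)) 0
  along-turn zero e = cong (_∸ 1) e
  along-turn (suc zero) {t} e = trans (cong (_∸ suc t) (sym e)) (n∸n≡0 (suc t))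
  along-turn (suc (suc n)) e = along-turn n e

  -- Tile k is traversed column by column (c < R + r), alternately upwards and
  -- downwards, and then row by row (s < R - r), alternately leftwards and
  -- rightwards; every segment has r cells and t counts the cells already
  -- walked in it.
  data Position : Set where
    column : (k c t : ℕ) → Position
    row    : (k s t : ℕ) → Position

  Valid : Position → Set
  Valid (column _ c t) = c < R + r × t < r
  Valid (row _ s t)    = s < R ∸ r × t < r

  cell : Position → Cell
  cell (column k c t) = k , c , along (parity c) t
  cell (row k s t)    = k , R + along (parity (suc s)) t , r + s

  segment : Position → ℕ
  segment (column k c _) = k * (2 * R) + c
  segment (row k s _)    = k * (2 * R) + (R + r + s)

  offset : Position → ℕ
  offset (column _ _ t) = t
  offset (row _ _ t)    = t

  rank : Position → ℕ
  rank p = segment p * r + offset p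

  r+s<R : ∀ {s} → s < R ∸ r → r + s < R
  r+s<R {s} s<R∸r = subst (r + s <_) (m+[n∸m]≡n (<⇒≤ r<R)) (+-monoʳ-< r s<R∸r)

  valid⇒InTile : ∀ {p} → Valid p → InTile (cell p)
  valid⇒InTile {column _ c _} (c<R+r , t<r) =
    in-tile c<R+r (<-trans (along-< (parity c) t<r) r<R) (inj₁ (along-< (parity c) t<r))
  valid⇒InTile {row _ s _} (s<R∸r , t<r) =
    in-tile (+-monoʳ-< R (along-< (parity (suc s)) t<r)) (r+s<R s<R∸r) (inj₂ (m≤m+n R _))

  position-injective : ∀ {p p′} → Valid p → Valid p′ → cell p ≡ cell p′ → p ≡ p′
  position-injective {column k c t} {column k′ c′ t′} (_ , t<r) (_ , t′<r) e with ,-injective e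
  ... | refl , e′ with ,-injective e′
  ...   | refl , along≡ = cong (column k c) (along-injective (parity c) t<r t′<r along≡)
  position-injective {column k c t} {row k′ s′ t′} (_ , t<r) _ e =
    ⊥-elim (<⇒≱ (along-< (parity c) t<r) (subst (r ≤_) (sym (,-injectiveʳ (,-injectiveʳ e))) (m≤m+n r s′)))
  position-injective {row k s t} {column k′ c′ t′} _ (_ , t′<r) e =
    ⊥-elim (<⇒≱ (along-< (parity c′) t′<r) (subst (r ≤_) (,-injectiveʳ (,-injectiveʳ e)) (m≤m+n r s)))
  position-injective {row k s t} {row k′ s′ t′} (_ , t<r) (_ , t′<r) e with ,-injective e
  ... | refl , e′ with ,-injective e′
  ...   | u≡ , r+s≡ with +-cancelˡ-≡ r s s′ r+s≡
  ...     | refl = cong (row k s) (along-injective (parity (suc s)) t<r t′<r (+-cancelˡ-≡ R _ _ u≡))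

  CellStep : Cell → Cell → Set
  CellStep c c′ = ∣ cellS c - cellS c′ ∣ ≡ 1 × ∣ cellT c - cellT c′ ∣ ≡ 1

  u-move : ∀ k u u′ v → ∣ u - u′ ∣ ≡ 1 → CellStep (k , u , v) (k , u′ , v)
  u-move k u u′ v ∣Δu∣≡1 =
    trans (∣m+o-n+o∣≡∣m-n∣ (u + v) (u′ + v) (k * (2 * R))) (trans (∣m+o-n+o∣≡∣m-n∣ u u′ v) ∣Δu∣≡1) ,
    trans (∣m+o-n+o∣≡∣m-n∣ u u′ (R ∸ v)) ∣Δu∣≡1

  v-move : ∀ k u v v′ → v ≤ R → v′ ≤ R → ∣ v - v′ ∣ ≡ 1 → CellStep (k , u , v) (k , u , v′)
  v-move k u v v′ v≤R v′≤R ∣Δv∣≡1 =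
    trans (∣m+o-n+o∣≡∣m-n∣ (u + v) (u + v′) (k * (2 * R))) (trans (∣m+n-m+o∣≡∣n-o∣ u v v′) ∣Δv∣≡1) ,
    trans (∣m+n-m+o∣≡∣n-o∣ u (R ∸ v) (R ∸ v′)) (trans (∣m∸n-m∸o∣≡∣n-o∣ v≤R v′≤R) ∣Δv∣≡1)

  period-move : ∀ k → CellStep (k , R , pred R) (suc k , 0 , 0)
  period-move k =
    subst (λ x → ∣ cellS (k , R , pred R) - x ∣ ≡ 1) next-S (∣n-1+n∣≡1 (cellS (k , R , pred R))) ,
    trans (cong (λ x → ∣ R + x - R ∣) R∸pred[R]≡1)
      (trans (cong ∣_- R ∣ (+-comm R 1)) (trans (∣-∣-comm (suc R) R) (∣n-1+n∣≡1 R)))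
    where
    R∸pred[R]≡1 : R ∸ pred R ≡ 1
    R∸pred[R]≡1 = trans (cong (_∸ pred R) (sym (suc-pred R))) (m+n∸n≡m 1 (pred R))
    next-S : suc (cellS (k , R , pred R)) ≡ cellS (suc k , 0 , 0)
    next-S = begin
      suc (R + pred R + k * (2 * R))   ≡⟨ cong (_+ k * (2 * R)) (+-suc R (pred R)) ⟨
      R + suc (pred R) + k * (2 * R)   ≡⟨ cong (λ x → R + x + k * (2 * R)) (suc-pred R) ⟩
      R + R + k * (2 * R)              ≡⟨ cong (λ x → R + x + k * (2 * R)) (+-identityʳ R) ⟨
      2 * R + k * (2 * R)              ∎
      where open ≡-Reasoning

  Step : Position → Position → Set
  Step p p′ = CellStep (cell p) (cell p′)

  record Successor (p : Position) : Set where
    field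
      next : Position
      next-valid : Valid next
      rank-next : rank next ≡ suc (rank p)
      step : Step p next

  rank-carry : ∀ {p p′} → segment p′ ≡ suc (segment p) → offset p′ ≡ 0 → suc (offset p) ≡ r → rank p′ ≡ suc (rank p)
  rank-carry {p} {p′} seg≡ off≡ t+1≡r = begin
    segment p′ * r + offset p′        ≡⟨ cong₂ (λ J t → J * r + t) seg≡ off≡ ⟩
    suc (segment p) * r + 0           ≡⟨ +-identityʳ _ ⟩
    r + segment p * r                 ≡⟨ +-comm r _ ⟩
    segment p * r + r                 ≡⟨ cong (segment p * r +_) t+1≡r ⟨
    segment p * r + suc (offset p)    ≡⟨ +-suc _ (offset p) ⟩
    suc (segment p * r + offset p)    ∎
    where open ≡-Reasoning

  1+[r∸1]≡r : suc (r ∸ 1) ≡ r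
  1+[r∸1]≡r = trans (+-comm 1 (r ∸ 1)) (m∸n+n≡m 1≤r)

  odd-difference : 2 ∤ R ∸ r
  odd-difference 2∣R∸r = odd (subst (2 ∣_) regroup (∣m∣n⇒∣m+n 2∣R∸r (m∣m*n r)))
    where
    regroup : R ∸ r + 2 * r ≡ R + r
    regroup = trans (cong (R ∸ r +_) (cong (r +_) (+-identityʳ r)))
                (trans (sym (+-assoc (R ∸ r) r r)) (cong (_+ r) (m∸n+n≡m (<⇒≤ r<R))))

  column-climb : ∀ k {c t} → c < R + r → suc t < r → Successor (column k c t)
  column-climb k {c} {t} c<R+r t+1<r = record
    { next = column k c (suc t)
    ; next-valid = c<R+r , t+1<r
    ; rank-next = +-suc (segment (column k c t) * r) t
    ; step = v-move k c _ _ (along≤R (parity c) (<-trans (n<1+n t) t+1<r)) (along≤R (parity c) t+1<r)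
               (along-step (parity c) t+1<r)
    }

  column-next : ∀ k {c t} → suc c < R + r → suc t ≡ r → Successor (column k c t)
  column-next k {c} {t} c+1<R+r t+1≡r = record
    { next = column k (suc c) 0
    ; next-valid = c+1<R+r , 1≤r
    ; rank-next = rank-carry {column k c t} {column k (suc c) 0} (+-suc (k * (2 * R)) c) refl t+1≡r
    ; step = subst (λ v → CellStep (k , c , along (parity c) t) (k , suc c , v)) (along-turn c t+1≡r)
               (u-move k c (suc c) _ (∣n-1+n∣≡1 c))
    }

  column-to-row : ∀ k {c t} → suc c ≡ R + r → suc t ≡ r → Successor (column k c t)
  column-to-row k {c} {t} c+1≡R+r t+1≡r = record
    { next = row k 0 0
    ; next-valid = m<n⇒0<n∸m r<R , 1≤r
    ; rank-next = rank-carry {column k c t} {row k 0 0}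
        (trans (cong (k * (2 * R) +_) (trans (+-identityʳ (R + r)) (sym c+1≡R+r))) (+-suc _ c)) refl t+1≡r
    ; step = subst₂ (λ v u → CellStep (k , c , v) (k , u , r + 0)) (sym v≡r∸1) c≡R+[r∸1]
               (v-move k c (r ∸ 1) (r + 0) (≤-trans (m∸n≤m r 1) (<⇒≤ r<R)) (subst (_≤ R) (sym (+-identityʳ r)) (<⇒≤ r<R))
                 (subst (λ x → ∣ r ∸ 1 - x ∣ ≡ 1) (trans 1+[r∸1]≡r (sym (+-identityʳ r))) (∣n-1+n∣≡1 (r ∸ 1))))
    }
    where
    v≡r∸1 : along (parity c) t ≡ r ∸ 1
    v≡r∸1 = trans (along-turn c t+1≡r)
              (cong (λ p → along p 0) (odd-parity (suc c) (subst (2 ∤_) (sym c+1≡R+r) odd)))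
    c≡R+[r∸1] : c ≡ R + (r ∸ 1)
    c≡R+[r∸1] = trans (cong (_∸ 1) c+1≡R+r) (+-∸-assoc R 1≤r)

  row-climb : ∀ k {s t} → s < R ∸ r → suc t < r → Successor (row k s t)
  row-climb k {s} {t} s<R∸r t+1<r = record
    { next = row k s (suc t)
    ; next-valid = s<R∸r , t+1<r
    ; rank-next = +-suc (segment (row k s t) * r) t
    ; step = u-move k (R + along (parity (suc s)) t) (R + along (parity (suc s)) (suc t)) (r + s)
               (trans (∣m+n-m+o∣≡∣n-o∣ R _ _) (along-step (parity (suc s)) t+1<r))
    }

  row-next : ∀ k {s t} → suc s < R ∸ r → suc t ≡ r → Successor (row k s t)
  row-next k {s} {t} s+1<R∸r t+1≡r = record
    { next = row k (suc s) 0
    ; next-valid = s+1<R∸r , 1≤r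
    ; rank-next = rank-carry {row k s t} {row k (suc s) 0}
        (trans (cong (k * (2 * R) +_) (+-suc (R + r) s)) (+-suc _ _)) refl t+1≡r
    ; step = subst (λ a → CellStep (k , R + along (parity (suc s)) t , r + s) (k , R + a , r + suc s))
               (along-turn (suc s) t+1≡r)
               (v-move k (R + along (parity (suc s)) t) (r + s) (r + suc s) (<⇒≤ (r+s<R (<-trans (n<1+n s) s+1<R∸r))) (<⇒≤ (r+s<R s+1<R∸r))
                 (trans (∣m+n-m+o∣≡∣n-o∣ r s (suc s)) (∣n-1+n∣≡1 s)))
    }

  next-period : ∀ k {s t} → suc s ≡ R ∸ r → suc t ≡ r → Successor (row k s t)
  next-period k {s} {t} s+1≡R∸r t+1≡r = record
    { next = column (suc k) 0 0
    ; next-valid = ≤-trans 1≤r (m≤n+m r R) , 1≤r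
    ; rank-next = rank-carry {row k s t} {column (suc k) 0 0} segment≡ refl t+1≡r
    ; step = subst₂ (λ u v → CellStep (k , u , v) (suc k , 0 , 0)) (sym u≡R) (sym v≡pred[R]) (period-move k)
    }
    where
    open ≡-Reasoning
    r+[1+s]≡R : r + suc s ≡ R
    r+[1+s]≡R = trans (cong (r +_) s+1≡R∸r) (m+[n∸m]≡n (<⇒≤ r<R))
    u≡R : R + along (parity (suc s)) t ≡ R
    u≡R = begin
      R + along (parity (suc s)) t ≡⟨ cong (λ p → R + along p t) (odd-parity (suc s) (subst (2 ∤_) (sym s+1≡R∸r) odd-difference)) ⟩
      R + (r ∸ suc t)              ≡⟨ cong (λ x → R + (x ∸ suc t)) t+1≡r ⟨
      R + (suc t ∸ suc t)          ≡⟨ cong (R +_) (n∸n≡0 (suc t)) ⟩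
      R + 0                        ≡⟨ +-identityʳ R ⟩
      R                            ∎
    v≡pred[R] : r + s ≡ pred R
    v≡pred[R] = cong pred (trans (sym (+-suc r s)) r+[1+s]≡R)
    segment≡ : suc k * (2 * R) + 0 ≡ suc (k * (2 * R) + (R + r + s))
    segment≡ = begin
      suc k * (2 * R) + 0          ≡⟨ +-identityʳ _ ⟩
      2 * R + k * (2 * R)          ≡⟨ +-comm (2 * R) _ ⟩
      k * (2 * R) + 2 * R          ≡⟨ cong (λ x → k * (2 * R) + (R + x)) (trans (+-identityʳ R) (sym r+[1+s]≡R)) ⟩
      k * (2 * R) + (R + (r + suc s)) ≡⟨ cong (k * (2 * R) +_) (+-assoc R r (suc s)) ⟨
      k * (2 * R) + (R + r + suc s) ≡⟨ cong (k * (2 * R) +_) (+-suc (R + r) s) ⟩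
      k * (2 * R) + suc (R + r + s) ≡⟨ +-suc _ _ ⟩
      suc (k * (2 * R) + (R + r + s)) ∎

  successor : ∀ p → Valid p → Successor p
  successor (column k c t) (c<R+r , t<r) with suc t <? r
  ... | yes t+1<r = column-climb k c<R+r t+1<r
  ... | no t+1≮r with suc c <? R + r
  ...   | yes c+1<R+r = column-next k c+1<R+r (<∧≮1+⇒1+≡ t<r t+1≮r)
  ...   | no c+1≮R+r = column-to-row k (<∧≮1+⇒1+≡ c<R+r c+1≮R+r) (<∧≮1+⇒1+≡ t<r t+1≮r)
  successor (row k s t) (s<R∸r , t<r) with suc t <? r
  ... | yes t+1<r = row-climb k s<R∸r t+1<r
  ... | no t+1≮r with suc s <? R ∸ r
  ...   | yes s+1<R∸r = row-next k s+1<R∸r (<∧≮1+⇒1+≡ t<r t+1≮r)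
  ...   | no s+1≮R∸r = next-period k (<∧≮1+⇒1+≡ s<R∸r s+1≮R∸r) (<∧≮1+⇒1+≡ t<r t+1≮r)

  walk : (i : ℕ) → Σ[ p ∈ Position ] Valid p × rank p ≡ i
  walk zero = column 0 0 0 , (≤-trans 1≤r (m≤n+m r R) , 1≤r) , refl
  walk (suc i) = next , next-valid , trans rank-next (cong suc (proj₂ (proj₂ (walk i))))
    where open Successor (successor (proj₁ (walk i)) (proj₁ (proj₂ (walk i))))

  position : ℕ → Position
  position i = proj₁ (walk i)

  position-valid : ∀ i → Valid (position i)
  position-valid i = proj₁ (proj₂ (walk i))

  rank-position : ∀ i → rank (position i) ≡ i
  rank-position i = proj₂ (proj₂ (walk i))

  position-step : ∀ i → Step (position i) (position (suc i))
  position-step i = Successor.step (successor (position i) (position-valid i))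

  cellS≤segment+r : ∀ {p} → Valid p → cellS (cell p) ≤ segment p + r
  cellS≤segment+r {column k c t} (_ , t<r) = begin
    c + along (parity c) t + k * (2 * R) ≡⟨ rearrange c (along (parity c) t) (k * (2 * R)) ⟩
    k * (2 * R) + c + along (parity c) t ≤⟨ +-monoʳ-≤ (k * (2 * R) + c) (<⇒≤ (along-< (parity c) t<r)) ⟩
    k * (2 * R) + c + r                  ∎
    where
    open ≤-Reasoning
    rearrange : ∀ c a K → c + a + K ≡ K + c + a
    rearrange = solve-∀
  cellS≤segment+r {row k s t} (_ , t<r) = begin
    R + a + (r + s) + k * (2 * R)       ≡⟨ rearrange R a r s (k * (2 * R)) ⟩
    k * (2 * R) + (R + r + s) + a       ≤⟨ +-monoʳ-≤ (k * (2 * R) + (R + r + s)) (<⇒≤ (along-< (parity (suc s)) t<r)) ⟩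
    k * (2 * R) + (R + r + s) + r       ∎
    where
    open ≤-Reasoning
    a : ℕ
    a = along (parity (suc s)) t
    rearrange : ∀ R a r s K → R + a + (r + s) + K ≡ K + (R + r + s) + a
    rearrange = solve-∀

  r*cellS≤rank+r*r : ∀ {p} → Valid p → r * cellS (cell p) ≤ rank p + r * r
  r*cellS≤rank+r*r {p} valid = begin
    r * cellS (cell p)             ≤⟨ *-monoʳ-≤ r (cellS≤segment+r valid) ⟩
    r * (segment p + r)            ≡⟨ *-distribˡ-+ r (segment p) r ⟩
    r * segment p + r * r          ≡⟨ cong (_+ r * r) (*-comm r (segment p)) ⟩
    segment p * r + r * r          ≤⟨ +-monoˡ-≤ (r * r) (m≤m+n (segment p * r) (offset p)) ⟩
    rank p + r * r                 ∎
    where open ≤-Reasoning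

  staircase : DiagonalWalk r R
  staircase = record
    { S = cellS ∘ cell ∘ position
    ; T = cellT ∘ cell ∘ position
    ; S-step = proj₁ ∘ position-step
    ; T-step = proj₂ ∘ position-step
    ; sum-parity = λ i j → even-sum (cell-parity (tile i)) (cell-parity (tile j))
    ; injective = λ {i} {j} S≡ T≡ → trans (sym (rank-position i)) (trans (cong rank
        (position-injective (position-valid i) (position-valid j) (cell-injective (tile i) (tile j) S≡ T≡))) (rank-position j))
    ; T-close = λ i j → cell-T-close (tile i) (tile j)
    ; spread = r * r + R * (2 * R + r)
    ; bounded = bounded
    }
    where
    bounded : ∀ i j → r * cellS (cell (position i)) + R * cellT (cell (position j)) ≤ i + (r * r + R * (2 * R + r))
    bounded i j = begin
      r * cellS (cell (position i)) + R * cellT (cell (position j))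
        ≤⟨ +-mono-≤ (r*cellS≤rank+r*r (position-valid i)) (*-monoʳ-≤ R (cellT≤ (valid⇒InTile (position-valid j)))) ⟩
      rank (position i) + r * r + R * (2 * R + r)
        ≡⟨ cong (λ x → x + r * r + R * (2 * R + r)) (rank-position i) ⟩
      i + r * r + R * (2 * R + r)
        ≡⟨ +-assoc i (r * r) _ ⟩
      i + (r * r + R * (2 * R + r)) ∎
      where open ≤-Reasoning
    tile : ∀ i → InTile (cell (position i))
    tile i = valid⇒InTile (position-valid i)
    even-sum : ∀ {x y} → ∃[ a ] x ≡ 2 * a + R → ∃[ b ] y ≡ 2 * b + R → 2 ∣ x + y
    even-sum (a , refl) (b , refl) = divides (a + b + R) (regroup a b R)
      where
      regroup : ∀ a b R → 2 * a + R + (2 * b + R) ≡ (a + b + R) * 2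
      regroup = solve-∀

%2≡1⇒2∤ : ∀ n → n % 2 ≡ 1 → 2 ∤ n
%2≡1⇒2∤ n n%2≡1 2∣n = 0≢1+n (trans (sym (n∣m⇒m%n≡0 n 2 2∣n)) n%2≡1)

gridEmbedsLeaper-swap : ∀ {p q m n} → GridEmbedsLeaper q p m n → GridEmbedsLeaper p q m n
gridEmbedsLeaper-swap (f , f-inj , f-adj) = f , f-inj , λ u v uv → Sum.swap (f-adj u v uv)

near-full-embeddings : ∀ p q → 1 ≤ p → 1 ≤ q → p ≢ q → Coprime p q → 2 ∤ p + q →
  ∃[ C ] ∀ m n → m + C ≤ n → GridEmbedsLeaper p q m n
near-full-embeddings p q 1≤p 1≤q p≢q coprime odd with <-cmp p q
... | tri< p<q _ _ = DiagonalWalk.spread walk , WalkEmbedding.walk-embeds walk {{>-nonZero 1≤q}} coprime odd′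
  where
  odd′ : 2 ∤ q + p
  odd′ = subst (2 ∤_) (+-comm p q) odd
  walk : DiagonalWalk p q
  walk = Staircase.staircase p q 1≤p p<q odd′
... | tri≈ _ p≡q _ = ⊥-elim (p≢q p≡q)
... | tri> _ _ q<p = DiagonalWalk.spread walk ,
  λ m n le → gridEmbedsLeaper-swap (WalkEmbedding.walk-embeds walk {{>-nonZero 1≤p}} (Coprime.sym coprime) odd m n le)
  where
  walk : DiagonalWalk q p
  walk = Staircase.staircase q p 1≤q q<p odd

theorem1 : (p q : ℕ) → 1 ≤ p → 1 ≤ q → p ≢ q → gcd p q ≡ 1 → (p + q) % 2 ≡ 1 →
    Σ ℕ λ C → (n : ℕ) → 1 ≤ n →
      Σ ℕ λ m → IsMaxGrid p q n m × ∣ m - n ∣ ≤ C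
theorem1 p q 1≤p 1≤q p≢q gcd≡1 odd
  with near-full-embeddings p q 1≤p 1≤q p≢q (gcd≡1⇒coprime gcd≡1) (%2≡1⇒2∤ (p + q) odd)
... | C , embeds = C , near-maximum p q C embeds
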